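{- Let $P\in\mathbb{Z}[x_1,\ldots,x_k]$ be a homogeneous polynomial such that the equation $P(x_1,\ldots,x_k)=0$ is partition regular on $\mathbb{N}$. Then for every $q\in\mathbb{Q}$, the equation $P_q(x_1,\ldots,x_{k+1})=0$, where $$P_q(x_1,\ldots,x_{k-1},x_k,x_{k+1}):=P(x_1,\ldots,x_{k-1},x_k+qx_{k+1}),$$ is partition regular on $\mathbb{N}$.
   Context: $\mathbb{N}=\{1,2,3,\dots\}$. An equation $P(x_1,\ldots,x_k)=0$ (with rational coefficients) is partition regular on $\mathbb{N}$ if for every finite coloring $\mathbb{N}=C_1\cup\cdots\cup C_r$ there exist $i$ and $n_1,\ldots,n_k\in C_i$ (not necessarily distinct) with $P(n_1,\ldots,n_k)=0$. -}

module Defs where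

open import Data.Nat as ℕ using (ℕ; zero; suc; _≥_)
open import Data.Integer as ℤ using (ℤ; +_; 0ℤ)
open import Data.Rational as ℚ using (ℚ; 0ℚ; 1ℚ; _+_; _*_; _/_)
open import Data.Fin as Fin using (Fin; fromℕ; inject₁)
open import Data.Vec as Vec using (Vec; []; _∷_)
open import Data.List as List using (List; filter; map; foldr)
open import Data.List.Membership.Propositional using (_∈_)
open import Data.Product using (Σ; _×_; _,_; ∃; proj₁; proj₂)
open import Relation.Binary.PropositionalEquality using (_≡_; _≢_)
open import Data.Vec.Properties using (≡-dec)
open import Relation.Nullary using (yes; no)

-- A polynomial in ℤ[x_1,…,x_k] is a finite formal sum of terms c · x^e,
-- each given as a pair (c , e) with coefficient c : ℤ and exponent vector e.
Monomial : ℕ → Set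
Monomial k = Vec ℕ k

Poly : ℕ → Set
Poly k = List (ℤ × Monomial k)

degree : ∀ {k} → Monomial k → ℕ
degree = Vec.foldr _ ℕ._+_ 0

coeff : ∀ {k} → Poly k → Monomial k → ℤ
coeff P e = foldr ℤ._+_ 0ℤ (map proj₁ (filter (λ t → ≡-dec ℕ._≟_ (proj₂ t) e) P))

Homogeneous : ∀ {k} → Poly k → Set
Homogeneous {k} P = ∃ λ d → ∀ (t : ℤ × Monomial k) → t ∈ P →
  coeff P (proj₂ t) ≢ + 0 → degree (proj₂ t) ≡ d

ℤ→ℚ : ℤ → ℚ
ℤ→ℚ z = z / 1

ℕ→ℚ : ℕ → ℚ
ℕ→ℚ n = ℤ→ℚ (+ n)

_^ℚ_ : ℚ → ℕ → ℚ
x ^ℚ zero = 1ℚ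
x ^ℚ suc n = x * (x ^ℚ n)

evalMono : ∀ {k} → Monomial k → (Fin k → ℚ) → ℚ
evalMono [] x = 1ℚ
evalMono (a ∷ e) x = (x Fin.zero ^ℚ a) * evalMono e (λ i → x (Fin.suc i))

eval : ∀ {k} → Poly k → (Fin k → ℚ) → ℚ
eval P x = foldr _+_ 0ℚ (map (λ t → ℤ→ℚ (proj₁ t) * evalMono (proj₂ t) x) P)

-- Partition regularity on ℕ = {1,2,3,…} of a relation S on k-tuples:
-- for every finite colouring c : ℕ → Fin r (values at 0 are irrelevant),
-- there are a colour i and n_1,…,n_k ≥ 1, all of colour i, with S n.
PartitionRegular : (k : ℕ) → ((Fin k → ℕ) → Set) → Set
PartitionRegular k S =
  ∀ (r : ℕ) (c : ℕ → Fin r) → Σ (Fin r) λ i → Σ (Fin k → ℕ) λ n →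
    (∀ j → n j ≥ 1) × (∀ j → c (n j) ≡ i) × S n

ZeroOf : ∀ {k} → Poly k → (Fin k → ℕ) → Set
ZeroOf P n = eval P (λ j → ℕ→ℚ (n j)) ≡ 0ℚ

-- Variables are indexed 0,…,k: index m is x_k, index suc m is x_{k+1}.
evalPq : ∀ {m} → Poly (suc m) → ℚ → (Fin (suc (suc m)) → ℚ) → ℚ
evalPq {m} P q x = eval P y
  where
    y : Fin (suc m) → ℚ
    y j with j Fin.≟ fromℕ m
    ... | yes _ = x (inject₁ j) + q * x (fromℕ (suc m))
    ... | no _ = x (inject₁ j)

ZeroOfPq : ∀ {m} → Poly (suc m) → ℚ → (Fin (suc (suc m)) → ℕ) → Set
ZeroOfPq P q n = evalPq P q (λ j → ℕ→ℚ (n j)) ≡ 0ℚ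

-- Write q = a/b. Van der Waerden's theorem (by colour focusing) and an induction on the number of
-- colours give, for every r, a bound N such that each r-colouring of [1, N] has a monochromatic
-- triple y, y + a w, b w, hence a monochromatic s, t, u with s + q u = t. Colour x by its pattern
-- (c x, c (2 x), …, c (N x)); partition regularity of P yields a zero n of P of a single pattern,
-- so t ↦ c (t nₖ) colours [1, N] and provides such s, t, u. The point (t n₁, …, t nₖ₋₁, s nₖ, u nₖ)
-- is then monochromatic, and P_q vanishes there because s nₖ + q u nₖ = t nₖ and, by homogeneity,
-- P (t n) = tᵈ P n = 0.
module Submission where

open import Defs
open import Data.Nat as Nat using (ℕ; zero; suc; _≤_; _≥_; _<_; _^_; z≤n; s≤s)
import Data.Nat.Properties as ℕₚ
open import Data.Integer as Int using (ℤ; 0ℤ)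
import Data.Integer.Properties as ℤₚ
open import Data.Rational using (ℚ; 0ℚ; mkℚ; ↥_; ↧ₙ_; toℚᵘ)
import Data.Rational as Rational
import Data.Rational.Properties as ℚₚ
import Data.Rational.Unnormalised as ℚᵘ
import Data.Rational.Unnormalised.Properties as ℚᵘₚ
open import Data.Fin as Fin using (Fin; fromℕ; inject₁)
import Data.Fin.Properties as Finₚ
import Data.Fin.Relation.Unary.Top as Top
open import Data.Product using (Σ; _×_; _,_; proj₁; proj₂)
open import Data.Sum using (_⊎_; inj₁; inj₂; [_,_]′)
open import Data.Vec using ([]; _∷_)
open import Data.Vec.Properties using (≡-dec)
open import Data.List using ([]; _∷_; filter; map; foldr; length)
open import Data.List.Properties using (filter-reject; filter-notAll)
open import Data.List.Membership.Propositional using (_∈_)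
open import Data.List.Membership.Propositional.Properties using (∈-filter⁻)
open import Data.List.Relation.Unary.Any using (here)
open import Data.Empty using (⊥-elim)
open import Relation.Nullary using (yes; no; ¬_)
open import Relation.Unary using (Pred; Decidable)
open import Relation.Unary.Properties using (∁?)
open import Algebra.Bundles using (CommutativeMonoid)
import Algebra.Properties.CommutativeSemigroup as CommSemigroupProperties
import Algebra.Properties.CommutativeMonoid.Mult as CommMonoidMult
open import Function using (id; _∘_; case_of_)
open import Function.Definitions using (Injective)
open import Relation.Binary.PropositionalEquality

module _ where
  open Rational using (_+_; _*_)
  open Int using (+_)
  open ℚᵘₚ.≃-Reasoning
  open import Data.Integer.Tactic.RingSolver using (solve-∀)

  toℚᵘ-ℤ→ℚ : ∀ z → toℚᵘ (ℤ→ℚ z) ℚᵘ.≃ ℚᵘ.mkℚᵘ z 0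
  toℚᵘ-ℤ→ℚ z = ℚₚ.toℚᵘ-fromℚᵘ (ℚᵘ.mkℚᵘ z 0)

  ℤ→ℚ-+ : ∀ x y → ℤ→ℚ (x Int.+ y) ≡ ℤ→ℚ x + ℤ→ℚ y
  ℤ→ℚ-+ x y = ℚₚ.toℚᵘ-injective (begin
    toℚᵘ (ℤ→ℚ (x Int.+ y))              ≈⟨ toℚᵘ-ℤ→ℚ (x Int.+ y) ⟩
    ℚᵘ.mkℚᵘ (x Int.+ y) 0               ≈⟨ ℚᵘ.*≡* (numerators x y) ⟩
    ℚᵘ.mkℚᵘ x 0 ℚᵘ.+ ℚᵘ.mkℚᵘ y 0        ≈⟨ ℚᵘₚ.+-cong (toℚᵘ-ℤ→ℚ x) (toℚᵘ-ℤ→ℚ y) ⟨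
    toℚᵘ (ℤ→ℚ x) ℚᵘ.+ toℚᵘ (ℤ→ℚ y)      ≈⟨ ℚₚ.toℚᵘ-homo-+ (ℤ→ℚ x) (ℤ→ℚ y) ⟨
    toℚᵘ (ℤ→ℚ x + ℤ→ℚ y)                ∎)
    where
    numerators : ∀ x y → (x Int.+ y) Int.* + 1 ≡ (x Int.* + 1 Int.+ y Int.* + 1) Int.* + 1
    numerators = solve-∀

  ℤ→ℚ-* : ∀ x y → ℤ→ℚ (x Int.* y) ≡ ℤ→ℚ x * ℤ→ℚ y
  ℤ→ℚ-* x y = ℚₚ.toℚᵘ-injective (begin
    toℚᵘ (ℤ→ℚ (x Int.* y))              ≈⟨ toℚᵘ-ℤ→ℚ (x Int.* y) ⟩
    ℚᵘ.mkℚᵘ x 0 ℚᵘ.* ℚᵘ.mkℚᵘ y 0        ≈⟨ ℚᵘₚ.*-cong (toℚᵘ-ℤ→ℚ x) (toℚᵘ-ℤ→ℚ y) ⟨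
    toℚᵘ (ℤ→ℚ x) ℚᵘ.* toℚᵘ (ℤ→ℚ y)      ≈⟨ ℚₚ.toℚᵘ-homo-* (ℤ→ℚ x) (ℤ→ℚ y) ⟨
    toℚᵘ (ℤ→ℚ x * ℤ→ℚ y)                ∎)

  ℕ→ℚ-* : ∀ m n → ℕ→ℚ (m Nat.* n) ≡ ℕ→ℚ m * ℕ→ℚ n
  ℕ→ℚ-* m n = trans (cong ℤ→ℚ (ℤₚ.pos-* m n)) (ℤ→ℚ-* (+ m) (+ n))

  *-↧≡↥ : ∀ q → q * ℕ→ℚ (↧ₙ q) ≡ ℤ→ℚ (↥ q)
  *-↧≡↥ q@(mkℚ n d _) = ℚₚ.toℚᵘ-injective (begin
    toℚᵘ (q * ℕ→ℚ (suc d))               ≈⟨ ℚₚ.toℚᵘ-homo-* q (ℕ→ℚ (suc d)) ⟩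
    toℚᵘ q ℚᵘ.* toℚᵘ (ℕ→ℚ (suc d))       ≈⟨ ℚᵘₚ.*-congˡ {toℚᵘ q} (toℚᵘ-ℤ→ℚ (+ suc d)) ⟩
    ℚᵘ.mkℚᵘ n d ℚᵘ.* ℚᵘ.mkℚᵘ (+ suc d) 0  ≈⟨ ℚᵘ.*≡* cross-multiplied ⟩
    ℚᵘ.mkℚᵘ n 0                          ≈⟨ toℚᵘ-ℤ→ℚ n ⟨
    toℚᵘ (ℤ→ℚ n)                         ∎)
    where
    cross-multiplied : n Int.* + suc d Int.* + 1 ≡ n Int.* + (suc d Nat.* 1)
    cross-multiplied = trans (ℤₚ.*-identityʳ (n Int.* + suc d))
                             (cong (λ e → n Int.* + e) (sym (ℕₚ.*-identityʳ (suc d))))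

-- Homogeneous polynomials

filter-absorb : ∀ {a p q} {A : Set a} {P : Pred A p} {Q : Pred A q}
                (P? : Decidable P) (Q? : Decidable Q) →
                (∀ {x} → P x → Q x) → ∀ xs → filter P? (filter Q? xs) ≡ filter P? xs
filter-absorb P? Q? P⇒Q [] = refl
filter-absorb P? Q? P⇒Q (x ∷ xs) with Q? x
... | no ¬Qx = trans (filter-absorb P? Q? P⇒Q xs) (sym (filter-reject P? (¬Qx ∘ P⇒Q)))
... | yes _ with P? x
...   | yes _ = cong (x ∷_) (filter-absorb P? Q? P⇒Q xs)
...   | no _ = filter-absorb P? Q? P⇒Q xs

module _ where
  open Rational using (_+_; _*_)
  open ≡-Reasoning
  open CommSemigroupProperties (CommutativeMonoid.commutativeSemigroup ℚₚ.+-0-commutativeMonoid)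
    using () renaming (x∙yz≈y∙xz to +-left-swap)
  open CommSemigroupProperties (CommutativeMonoid.commutativeSemigroup ℚₚ.*-1-commutativeMonoid)
    using (interchange) renaming (x∙yz≈y∙xz to *-left-swap)
  open CommMonoidMult ℚₚ.*-1-commutativeMonoid
    using (×-distrib-+; ×-homo-+) renaming (_×_ to _×ᵐ_)

  ^ℚ≡×ᵐ : ∀ x n → x ^ℚ n ≡ n ×ᵐ x
  ^ℚ≡×ᵐ x zero = refl
  ^ℚ≡×ᵐ x (suc n) = cong (x *_) (^ℚ≡×ᵐ x n)

  ^ℚ-distrib-* : ∀ x y n → (x * y) ^ℚ n ≡ x ^ℚ n * y ^ℚ n
  ^ℚ-distrib-* x y n rewrite ^ℚ≡×ᵐ (x * y) n | ^ℚ≡×ᵐ x n | ^ℚ≡×ᵐ y n = ×-distrib-+ x y n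

  ^ℚ-+ : ∀ x m n → x ^ℚ (m Nat.+ n) ≡ x ^ℚ m * x ^ℚ n
  ^ℚ-+ x m n rewrite ^ℚ≡×ᵐ x (m Nat.+ n) | ^ℚ≡×ᵐ x m | ^ℚ≡×ᵐ x n = ×-homo-+ x m n

  evalMono-cong : ∀ {k} (e : Monomial k) {x y} → (∀ j → x j ≡ y j) → evalMono e x ≡ evalMono e y
  evalMono-cong [] x≗y = refl
  evalMono-cong (a ∷ e) x≗y =
    cong₂ _*_ (cong (_^ℚ a) (x≗y Fin.zero)) (evalMono-cong e (x≗y ∘ Fin.suc))

  evalMono-scale : ∀ {k} (e : Monomial k) T x →
                   evalMono e (λ j → T * x j) ≡ T ^ℚ degree e * evalMono e x
  evalMono-scale [] T x = sym (ℚₚ.*-identityˡ Rational.1ℚ)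
  evalMono-scale (a ∷ e) T x = begin
    (T * x₀) ^ℚ a * evalMono e (λ j → T * x (Fin.suc j))
      ≡⟨ cong₂ _*_ (^ℚ-distrib-* T x₀ a) (evalMono-scale e T (x ∘ Fin.suc)) ⟩
    (T ^ℚ a * x₀ ^ℚ a) * (T ^ℚ degree e * evalMono e (x ∘ Fin.suc))
      ≡⟨ interchange (T ^ℚ a) (x₀ ^ℚ a) (T ^ℚ degree e) (evalMono e (x ∘ Fin.suc)) ⟩
    (T ^ℚ a * T ^ℚ degree e) * (x₀ ^ℚ a * evalMono e (x ∘ Fin.suc))
      ≡⟨ cong (_* evalMono (a ∷ e) x) (^ℚ-+ T a (degree e)) ⟨
    T ^ℚ (a Nat.+ degree e) * evalMono (a ∷ e) x
      ∎
    where
    x₀ : ℚ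
    x₀ = x Fin.zero

  term : ∀ {k} → (Monomial k → ℚ) → ℤ × Monomial k → ℚ
  term F t = ℤ→ℚ (proj₁ t) * F (proj₂ t)

  -- `eval P x` unfolds to `termSum P (λ e → evalMono e x)`, so the lemmas below apply to `eval` as is.
  termSum : ∀ {k} → Poly k → (Monomial k → ℚ) → ℚ
  termSum P F = foldr _+_ 0ℚ (map (term F) P)

  hasMonomial : ∀ {k} (e : Monomial k) → Decidable (λ (t : ℤ × Monomial k) → proj₂ t ≡ e)
  hasMonomial e t = ≡-dec Nat._≟_ (proj₂ t) e

  AgreeOnSupport : ∀ {k} → Poly k → (F G : Monomial k → ℚ) → Set
  AgreeOnSupport P F G = ∀ t → t ∈ P → coeff P (proj₂ t) ≢ 0ℤ → F (proj₂ t) ≡ G (proj₂ t)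

  termSum-split : ∀ {k p} {S : Pred (ℤ × Monomial k) p} (S? : Decidable S) P F →
                  termSum P F ≡ termSum (filter S? P) F + termSum (filter (∁? S?) P) F
  termSum-split S? [] F = sym (ℚₚ.+-identityˡ 0ℚ)
  termSum-split S? (t ∷ P) F with S? t
  ... | yes _ = trans (cong (term F t +_) (termSum-split S? P F))
                      (sym (ℚₚ.+-assoc (term F t) _ _))
  ... | no _ = trans (cong (term F t +_) (termSum-split S? P F))
                     (+-left-swap (term F t) (termSum (filter S? P) F) (termSum (filter (∁? S?) P) F))

  termSum-monomial : ∀ {k} (P : Poly k) e F →
                     termSum (filter (hasMonomial e) P) F ≡ ℤ→ℚ (coeff P e) * F e
  termSum-monomial [] e F = sym (ℚₚ.*-zeroˡ (F e))
  termSum-monomial (t ∷ P) e F with hasMonomial e t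
  ... | no _ = termSum-monomial P e F
  ... | yes refl = begin
    ℤ→ℚ (proj₁ t) * F e + termSum (filter (hasMonomial e) P) F
      ≡⟨ cong (ℤ→ℚ (proj₁ t) * F e +_) (termSum-monomial P e F) ⟩
    ℤ→ℚ (proj₁ t) * F e + ℤ→ℚ (coeff P e) * F e
      ≡⟨ ℚₚ.*-distribʳ-+ (F e) (ℤ→ℚ (proj₁ t)) (ℤ→ℚ (coeff P e)) ⟨
    (ℤ→ℚ (proj₁ t) + ℤ→ℚ (coeff P e)) * F e
      ≡⟨ cong (_* F e) (ℤ→ℚ-+ (proj₁ t) (coeff P e)) ⟨
    ℤ→ℚ (proj₁ t Int.+ coeff P e) * F e
      ∎

  coeff-without : ∀ {k} (P : Poly k) {e e′} → e′ ≢ e →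
                  coeff (filter (∁? (hasMonomial e)) P) e′ ≡ coeff P e′
  coeff-without P e′≢e = cong (foldr Int._+_ 0ℤ ∘ map proj₁)
    (filter-absorb (hasMonomial _) (∁? (hasMonomial _)) (λ { refl refl → e′≢e refl }) P)

  ℤ→ℚ-*-cong-nonzero : ∀ c {x y} → (c ≢ 0ℤ → x ≡ y) → ℤ→ℚ c * x ≡ ℤ→ℚ c * y
  ℤ→ℚ-*-cong-nonzero c {x} {y} x≡y with c Int.≟ 0ℤ
  ... | yes refl = trans (ℚₚ.*-zeroˡ x) (sym (ℚₚ.*-zeroˡ y))
  ... | no c≢0 = cong (ℤ→ℚ c *_) (x≡y c≢0)

  -- `Homogeneous` says nothing about monomials whose collected coefficient vanishes, so the sum is
  -- regrouped monomial by monomial; the recursion is on length since the rest is a filtered list.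
  termSum-cong-support : ∀ {k} (P : Poly k) {F G} → AgreeOnSupport P F G → termSum P F ≡ termSum P G
  termSum-cong-support {k} P {F} {G} = bounded (suc (length P)) P ℕₚ.≤-refl
    where
    bounded : ∀ n (P : Poly k) → length P < n → AgreeOnSupport P F G → termSum P F ≡ termSum P G
    bounded _ [] _ _ = refl
    bounded (suc n) (t ∷ P) |t∷P|<1+n agree = begin
      termSum (t ∷ P) F
        ≡⟨ termSum-split (hasMonomial e) (t ∷ P) F ⟩
      termSum (filter (hasMonomial e) (t ∷ P)) F + termSum rest F
        ≡⟨ cong₂ _+_ (termSum-monomial (t ∷ P) e F) (bounded n rest |rest|<n agree-rest) ⟩
      ℤ→ℚ (coeff (t ∷ P) e) * F e + termSum rest G
        ≡⟨ cong (_+ termSum rest G) (ℤ→ℚ-*-cong-nonzero (coeff (t ∷ P) e) (agree t (here refl))) ⟩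
      ℤ→ℚ (coeff (t ∷ P) e) * G e + termSum rest G
        ≡⟨ cong (_+ termSum rest G) (termSum-monomial (t ∷ P) e G) ⟨
      termSum (filter (hasMonomial e) (t ∷ P)) G + termSum rest G
        ≡⟨ termSum-split (hasMonomial e) (t ∷ P) G ⟨
      termSum (t ∷ P) G
        ∎
      where
      e : Monomial k
      e = proj₂ t
      rest : Poly k
      rest = filter (∁? (hasMonomial e)) (t ∷ P)
      |rest|<n : length rest < n
      |rest|<n = ℕₚ.<-≤-trans (filter-notAll (∁? (hasMonomial e)) (t ∷ P) (here λ t≢e → t≢e refl))
                               (ℕₚ.≤-pred |t∷P|<1+n)
      agree-rest : AgreeOnSupport rest F G
      agree-rest t′ t′∈rest c≢0 with ∈-filter⁻ (∁? (hasMonomial e)) {xs = t ∷ P} t′∈rest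
      ... | t′∈P , t′≢e = agree t′ t′∈P (c≢0 ∘ trans (coeff-without (t ∷ P) t′≢e))

  termSum-scale : ∀ {k} (P : Poly k) c F → termSum P (λ e → c * F e) ≡ c * termSum P F
  termSum-scale [] c F = sym (ℚₚ.*-zeroʳ c)
  termSum-scale (t ∷ P) c F = begin
    ℤ→ℚ (proj₁ t) * (c * F (proj₂ t)) + termSum P (λ e → c * F e)
      ≡⟨ cong₂ _+_ (*-left-swap (ℤ→ℚ (proj₁ t)) c (F (proj₂ t))) (termSum-scale P c F) ⟩
    c * term F t + c * termSum P F
      ≡⟨ ℚₚ.*-distribˡ-+ c (term F t) (termSum P F) ⟨
    c * termSum (t ∷ P) F
      ∎

  eval-cong : ∀ {k} (P : Poly k) {x y} → (∀ j → x j ≡ y j) → eval P x ≡ eval P y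
  eval-cong P x≗y = termSum-cong-support P (λ t _ _ → evalMono-cong (proj₂ t) x≗y)

  eval-scale : ∀ {k} (P : Poly k) → ((d , _) : Homogeneous P) →
               ∀ T x → eval P (λ j → T * x j) ≡ T ^ℚ d * eval P x
  eval-scale P (d , homogeneous) T x = begin
    termSum P (λ e → evalMono e (λ j → T * x j))
      ≡⟨ termSum-cong-support P (λ t t∈P c≢0 →
           trans (evalMono-scale (proj₂ t) T x)
                 (cong (λ n → T ^ℚ n * evalMono (proj₂ t) x) (homogeneous t t∈P c≢0))) ⟩
    termSum P (λ e → T ^ℚ d * evalMono e x)
      ≡⟨ termSum-scale P (T ^ℚ d) (λ e → evalMono e x) ⟩
    T ^ℚ d * eval P x
      ∎

-- Van der Waerden's theorem

module _ where
  open Nat using (_+_; _*_)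
  open ℕₚ using (≤-trans)
  open import Data.Nat.Tactic.RingSolver using (solve-∀)

  colourPattern : ∀ {r} → (ℕ → Fin r) → (N : ℕ) → Fin (r ^ N)
  colourPattern f zero = Fin.zero
  colourPattern f (suc N) = Fin.combine (f (suc N)) (colourPattern f N)

  colourPattern-injective : ∀ {r} (f g : ℕ → Fin r) N → colourPattern f N ≡ colourPattern g N →
                            ∀ {p} → 1 ≤ p → p ≤ N → f p ≡ g p
  colourPattern-injective f g zero _ {zero} () _
  colourPattern-injective f g zero _ {suc p} _ ()
  colourPattern-injective f g (suc N) same {p} 1≤p p≤1+N with p Nat.≟ suc N
  ... | yes refl =
          Finₚ.combine-injectiveˡ (f (suc N)) (colourPattern f N) (g (suc N)) (colourPattern g N) same
  ... | no p≢1+N = colourPattern-injective f g N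
          (Finₚ.combine-injectiveʳ (f (suc N)) (colourPattern f N) (g (suc N)) (colourPattern g N) same)
          1≤p (ℕₚ.≤-pred (ℕₚ.≤∧≢⇒< p≤1+N p≢1+N))

  record MonoAP {r} (c : ℕ → Fin r) (L W : ℕ) : Set where
    field
      start step : ℕ
      start≥1 : 1 ≤ start
      step≥1 : 1 ≤ step
      end≤ : start + L * step ≤ W
      step≤ : step ≤ W
      mono : ∀ j → j ≤ L → c (start + j * step) ≡ c start

  VanDerWaerden : ℕ → ℕ → Set
  VanDerWaerden L r = Σ ℕ λ W → ∀ (c : ℕ → Fin r) → MonoAP c L W

  MonoAP-weaken : ∀ {r} {c : ℕ → Fin r} {L W W′} → W ≤ W′ → MonoAP c L W → MonoAP c L W′
  MonoAP-weaken W≤W′ ap = record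
    { start = start ; step = step ; start≥1 = start≥1 ; step≥1 = step≥1
    ; end≤ = ≤-trans end≤ W≤W′ ; step≤ = ≤-trans step≤ W≤W′ ; mono = mono }
    where open MonoAP ap

  MonoAP-shift : ∀ {r} {c : ℕ → Fin r} {L W} o → MonoAP (λ x → c (o + x)) L W → MonoAP c L (o + W)
  MonoAP-shift {c = c} {L} o ap = record
    { start = o + start ; step = step
    ; start≥1 = ≤-trans start≥1 (ℕₚ.m≤n+m start o) ; step≥1 = step≥1
    ; end≤ = ≤-trans (ℕₚ.≤-reflexive (ℕₚ.+-assoc o start (L * step))) (ℕₚ.+-monoʳ-≤ o end≤)
    ; step≤ = ≤-trans step≤ (ℕₚ.m≤n+m _ o)
    ; mono = λ j j≤L → trans (cong c (ℕₚ.+-assoc o start (j * step))) (mono j j≤L)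
    }
    where open MonoAP ap

  record Focused {r} (c : ℕ → Fin r) (L W s : ℕ) : Set where
    field
      focus : ℕ
      colour : Fin s → Fin r
      start step : Fin s → ℕ
      start≥1 : ∀ i → 1 ≤ start i
      step≥1 : ∀ i → 1 ≤ step i
      mono : ∀ i j → j ≤ L → c (start i + j * step i) ≡ colour i
      focused : ∀ i → start i + suc L * step i ≡ focus
      focus≥1 : 1 ≤ focus
      focus≤ : focus ≤ W
      colour-injective : Injective _≡_ _≡_ colour

  Focused-close : ∀ {r} {c : ℕ → Fin r} {L W s} (F : Focused c L W s) i →
                  c (Focused.focus F) ≡ Focused.colour F i → MonoAP c (suc L) W
  Focused-close {c = c} {L} {W} F i focus-colour = record
    { start = start i ; step = step i ; start≥1 = start≥1 i ; step≥1 = step≥1 i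
    ; end≤ = end≤W
    ; step≤ = ≤-trans (ℕₚ.m≤m+n (step i) (L * step i)) (≤-trans (ℕₚ.m≤n+m _ (start i)) end≤W)
    ; mono = λ j j≤1+L → trans (mono-to-focus j j≤1+L) (sym start-colour)
    }
    where
    open Focused F
    end≤W : start i + suc L * step i ≤ W
    end≤W = subst (_≤ W) (sym (focused i)) focus≤
    start-colour : c (start i) ≡ colour i
    start-colour = trans (cong c (sym (ℕₚ.+-identityʳ (start i)))) (mono i 0 z≤n)
    mono-to-focus : ∀ j → j ≤ suc L → c (start i + j * step i) ≡ colour i
    mono-to-focus j j≤1+L with j Nat.≟ suc L
    ... | yes refl = trans (cong c (focused i)) focus-colour
    ... | no j≢1+L = mono i j (ℕₚ.≤-pred (ℕₚ.≤∧≢⇒< j≤1+L j≢1+L))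

  Focused-impossible : ∀ {r} {c : ℕ → Fin r} {L W} → ¬ Focused c L W (suc r)
  Focused-impossible {r} F = Finₚ.<⇒notInjective (ℕₚ.n<1+n r) (Focused.colour-injective F)

  block-offset : ∀ k n D j p → k * n + p + j * (D * n) ≡ (k + j * D) * n + p
  block-offset = solve-∀

  block-offset-step : ∀ k n D j a d → k * n + a + j * (d + D * n) ≡ (k + j * D) * n + (a + j * d)
  block-offset-step = solve-∀

  Focused-extend : ∀ {r} {c : ℕ → Fin r} {L n s W} k D → 1 ≤ D →
    (∀ j → j ≤ L → ∀ {p} → 1 ≤ p → p ≤ n → c ((k + j * D) * n + p) ≡ c (k * n + p)) →
    (F : Focused (λ x → c (k * n + x)) L n s) →
    (∀ i → c (k * n + Focused.focus F) ≢ Focused.colour F i) →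
    k * n + Focused.focus F + suc L * (D * n) ≤ W → Focused c L W (suc s)
  Focused-extend {c = c} {L} {n} k D D≥1 same-blocks F fresh bound = record
    { focus = k * n + focus + suc L * (D * n)
    ; colour = λ { Fin.zero → c (k * n + focus) ; (Fin.suc i) → colour i }
    ; start = λ { Fin.zero → k * n + focus ; (Fin.suc i) → k * n + start i }
    ; step = λ { Fin.zero → D * n ; (Fin.suc i) → step i + D * n }
    ; start≥1 = λ { Fin.zero → ≤-trans focus≥1 (ℕₚ.m≤n+m focus (k * n))
                  ; (Fin.suc i) → ≤-trans (start≥1 i) (ℕₚ.m≤n+m (start i) (k * n)) }
    ; step≥1 = λ { Fin.zero → ℕₚ.*-mono-≤ D≥1 (≤-trans focus≥1 focus≤)
                 ; (Fin.suc i) → ≤-trans (step≥1 i) (ℕₚ.m≤m+n (step i) (D * n)) }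
    ; mono = λ { Fin.zero j j≤L → trans (cong c (block-offset k n D j focus))
                                        (same-blocks j j≤L focus≥1 focus≤)
               ; (Fin.suc i) j j≤L → trans (cong c (block-offset-step k n D j (start i) (step i)))
                                           (trans (same-blocks j j≤L (term≥1 i j) (term≤n i j j≤L))
                                                  (mono i j j≤L)) }
    ; focused = λ { Fin.zero → refl
                  ; (Fin.suc i) → trans (regroup k n D (suc L) (start i) (step i))
                                        (cong (λ f → k * n + f + suc L * (D * n)) (focused i)) }
    ; focus≥1 = ≤-trans focus≥1 (≤-trans (ℕₚ.m≤n+m focus (k * n)) (ℕₚ.m≤m+n _ _))
    ; focus≤ = bound
    ; colour-injective = λ { {Fin.zero} {Fin.zero} _ → refl
                           ; {Fin.zero} {Fin.suc i} eq → ⊥-elim (fresh i eq)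
                           ; {Fin.suc i} {Fin.zero} eq → ⊥-elim (fresh i (sym eq))
                           ; {Fin.suc i} {Fin.suc i′} eq → cong Fin.suc (colour-injective eq) }
    }
    where
    open Focused F
    regroup : ∀ k n D l a d → k * n + a + l * (d + D * n) ≡ k * n + (a + l * d) + l * (D * n)
    regroup = solve-∀
    term≥1 : ∀ i j → 1 ≤ start i + j * step i
    term≥1 i j = ≤-trans (start≥1 i) (ℕₚ.m≤m+n (start i) (j * step i))
    term≤n : ∀ i j → j ≤ L → start i + j * step i ≤ n
    term≤n i j j≤L = ≤-trans (ℕₚ.+-monoʳ-≤ (start i) (ℕₚ.*-monoˡ-≤ (step i) (ℕₚ.m≤n⇒m≤1+n j≤L)))
                             (≤-trans (ℕₚ.≤-reflexive (focused i)) focus≤)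

  FocusingBound : ℕ → ℕ → ℕ → Set
  FocusingBound L r s = Σ ℕ λ W → ∀ (c : ℕ → Fin r) → MonoAP c (suc L) W ⊎ Focused c L W s

  focusing-zero : ∀ L r → FocusingBound L r 0
  focusing-zero L r = 1 , λ c → inj₂ (record
    { focus = 1 ; colour = λ () ; start = λ () ; step = λ () ; start≥1 = λ () ; step≥1 = λ ()
    ; mono = λ () ; focused = λ () ; focus≥1 = ℕₚ.≤-refl ; focus≤ = ℕₚ.≤-refl
    ; colour-injective = λ { {()} } })

  focusing-in-blocks : ∀ {r} {c : ℕ → Fin r} {L n s W} k D → 1 ≤ D → k + suc L * D ≤ W →
    (∀ j → j ≤ L → ∀ {p} → 1 ≤ p → p ≤ n → c ((k + j * D) * n + p) ≡ c (k * n + p)) →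
    MonoAP (λ x → c (k * n + x)) (suc L) n ⊎ Focused (λ x → c (k * n + x)) L n s →
    MonoAP c (suc L) (W * n + n) ⊎ Focused c L (W * n + n) (suc s)
  focusing-in-blocks {c = c} {L} {n} {W = W} k D D≥1 bound same-blocks = λ where
      (inj₁ ap) → inj₁ (from-block ap)
      (inj₂ F) → case Finₚ.any? (λ i → c (k * n + Focused.focus F) Finₚ.≟ Focused.colour F i) of λ where
        (yes (i , focus-colour)) → inj₁ (from-block (Focused-close F i focus-colour))
        (no fresh) → inj₂ (Focused-extend k D D≥1 same-blocks F (λ i eq → fresh (i , eq))
                                          (focus-in-range (Focused.focus≤ F)))
    where
    k≤W : k ≤ W
    k≤W = ≤-trans (ℕₚ.m≤m+n k (suc L * D)) bound
    from-block : MonoAP (λ x → c (k * n + x)) (suc L) n → MonoAP c (suc L) (W * n + n)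
    from-block ap = MonoAP-weaken (ℕₚ.+-monoˡ-≤ n (ℕₚ.*-monoˡ-≤ n k≤W)) (MonoAP-shift (k * n) ap)
    focus-in-range : ∀ {f} → f ≤ n → k * n + f + suc L * (D * n) ≤ W * n + n
    focus-in-range {f} f≤n = subst (_≤ W * n + n) (sym (block-offset k n D (suc L) f))
                                   (ℕₚ.+-mono-≤ (ℕₚ.*-monoˡ-≤ n bound) f≤n)

  -- Cut ℕ into blocks [k n + 1, k n + n] coloured by their pattern. A progression of L + 1 blocks of
  -- equal pattern turns a focused family inside its first block into one with an extra progression,
  -- running through the blocks' copies of the focus, unless that focus already extends a progression.
  focusing-suc : ∀ {L r s} → (∀ r′ → VanDerWaerden L r′) → FocusingBound L r s → FocusingBound L r (suc s)
  focusing-suc {L} {r} {s} vdw (n , focusing) = (W + W) * n + n , λ c →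
    let open MonoAP (proj₂ (vdw (r ^ n)) (λ k → colourPattern (λ p → c (k * n + p)) n))
                    renaming (start to k; step to D)
    in focusing-in-blocks k D step≥1
         (subst (_≤ W + W) (sym (next-term k L D)) (ℕₚ.+-mono-≤ end≤ step≤))
         (λ j j≤L → colourPattern-injective _ _ n (mono j j≤L))
         (focusing (λ x → c (k * n + x)))
    where
    W : ℕ
    W = proj₁ (vdw (r ^ n))
    next-term : ∀ k L D → k + suc L * D ≡ k + L * D + D
    next-term = solve-∀

  focusing : ∀ L r s → (∀ r′ → VanDerWaerden L r′) → FocusingBound L r s
  focusing L r zero _ = focusing-zero L r
  focusing L r (suc s) vdw = focusing-suc vdw (focusing L r s vdw)

  vanDerWaerden : ∀ L r → VanDerWaerden L r
  vanDerWaerden zero r = 1 , λ c → record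
    { start = 1 ; step = 1 ; start≥1 = ℕₚ.≤-refl ; step≥1 = ℕₚ.≤-refl
    ; end≤ = ℕₚ.≤-refl ; step≤ = ℕₚ.≤-refl ; mono = λ { zero _ → refl } }
  vanDerWaerden (suc L) r =
    let (W , bound) = focusing L r (suc r) (vanDerWaerden L)
    in W , λ c → [ id , ⊥-elim ∘ Focused-impossible ]′ (bound c)

-- Monochromatic triples y, y + a w, b w

module _ where
  open Nat using (_+_; _*_)
  open ℕₚ using (≤-trans)
  open import Data.Nat.Tactic.RingSolver using (solve-∀)

  record RadoTriple {r} (c : ℕ → Fin r) (a b N : ℕ) : Set where
    field
      y w : ℕ
      y≥1 : 1 ≤ y
      w≥1 : 1 ≤ w
      y+aw≤N : y + a * w ≤ N
      bw≤N : b * w ≤ N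
      colour-y+aw : c (y + a * w) ≡ c y
      colour-bw : c (b * w) ≡ c y

  RadoBound : ℕ → ℕ → ℕ → Set
  RadoBound a b r = Σ ℕ λ N → ∀ (c : ℕ → Fin r) → RadoTriple c a b N

  -- Points of colour κ get an arbitrary colour: this is only used where κ does not occur.
  recolourAvoiding : ∀ {r} → Fin (suc (suc r)) → (ℕ → Fin (suc (suc r))) → ℕ → Fin (suc r)
  recolourAvoiding κ c x with c x Finₚ.≟ κ
  ... | yes _ = Fin.zero
  ... | no cx≢κ = Fin.punchOut (cx≢κ ∘ sym)

  recolourAvoiding-injective : ∀ {r κ} (c : ℕ → Fin (suc (suc r))) {x z} → c x ≢ κ → c z ≢ κ →
                               recolourAvoiding κ c x ≡ recolourAvoiding κ c z → c x ≡ c z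
  recolourAvoiding-injective {κ = κ} c {x} {z} cx≢κ cz≢κ same with c x Finₚ.≟ κ | c z Finₚ.≟ κ
  ... | yes cx≡κ | _ = ⊥-elim (cx≢κ cx≡κ)
  ... | no _ | yes cz≡κ = ⊥-elim (cz≢κ cz≡κ)
  ... | no cx≢κ′ | no cz≢κ′ = Finₚ.punchOut-injective (cx≢κ′ ∘ sym) (cz≢κ′ ∘ sym) same

  RadoTriple-in-AP : ∀ {r a b W N₀ j} {c : ℕ → Fin r} (ap : MonoAP c (a * N₀) W) →
                     let open MonoAP ap in
                     1 ≤ j → j ≤ N₀ → c (b * step * j) ≡ c start → RadoTriple c a b (W + b * (W * N₀))
  RadoTriple-in-AP {a = a} {b} {W} {N₀} {j} {c} ap 1≤j j≤N₀ hit = record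
    { y = start ; w = step * j ; y≥1 = start≥1 ; w≥1 = ℕₚ.*-mono-≤ step≥1 1≤j
    ; y+aw≤N = ≤-trans (subst (_≤ start + a * N₀ * step) (cong (start +_) (sym (rotate a step j)))
                              (ℕₚ.+-monoʳ-≤ start (ℕₚ.*-monoˡ-≤ step aj≤aN₀)))
                       (≤-trans end≤ (ℕₚ.m≤m+n W _))
    ; bw≤N = ≤-trans (ℕₚ.*-monoʳ-≤ b (ℕₚ.*-mono-≤ step≤ j≤N₀)) (ℕₚ.m≤n+m _ W)
    ; colour-y+aw = trans (cong (λ x → c (start + x)) (rotate a step j)) (mono (a * j) aj≤aN₀)
    ; colour-bw = trans (cong c (sym (ℕₚ.*-assoc b step j))) hit
    }
    where
    open MonoAP ap
    aj≤aN₀ : a * j ≤ a * N₀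
    aj≤aN₀ = ℕₚ.*-monoʳ-≤ a j≤N₀
    rotate : ∀ a d j → a * (d * j) ≡ a * j * d
    rotate = solve-∀

  RadoTriple-dilate : ∀ {r a b N₀ N} {c : ℕ → Fin (suc (suc r))} {κ} m → 1 ≤ m → 1 ≤ b → m * N₀ ≤ N →
                      (∀ {x} → 1 ≤ x → x ≤ N₀ → c (m * x) ≢ κ) →
                      RadoTriple (recolourAvoiding κ (λ x → c (m * x))) a b N₀ → RadoTriple c a b N
  RadoTriple-dilate {a = a} {b} {N₀} {N} {c} m m≥1 b≥1 mN₀≤N avoids triple = record
    { y = m * y ; w = m * w
    ; y≥1 = ℕₚ.*-mono-≤ m≥1 y≥1 ; w≥1 = ℕₚ.*-mono-≤ m≥1 w≥1
    ; y+aw≤N = subst (_≤ N) (sym (factor-y+aw m y a w)) (dilate≤N y+aw≤N)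
    ; bw≤N = subst (_≤ N) (sym (factor-bw m b w)) (dilate≤N bw≤N)
    ; colour-y+aw = trans (cong c (factor-y+aw m y a w))
                          (recolourAvoiding-injective (λ x → c (m * x))
                             (avoids y+aw≥1 y+aw≤N) (avoids y≥1 y≤N₀) colour-y+aw)
    ; colour-bw = trans (cong c (factor-bw m b w))
                        (recolourAvoiding-injective (λ x → c (m * x))
                           (avoids bw≥1 bw≤N) (avoids y≥1 y≤N₀) colour-bw)
    }
    where
    open RadoTriple triple
    y+aw≥1 : 1 ≤ y + a * w
    y+aw≥1 = ≤-trans y≥1 (ℕₚ.m≤m+n y (a * w))
    y≤N₀ : y ≤ N₀
    y≤N₀ = ≤-trans (ℕₚ.m≤m+n y (a * w)) y+aw≤N
    bw≥1 : 1 ≤ b * w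
    bw≥1 = ℕₚ.*-mono-≤ b≥1 w≥1
    dilate≤N : ∀ {x} → x ≤ N₀ → m * x ≤ N
    dilate≤N x≤N₀ = ≤-trans (ℕₚ.*-monoʳ-≤ m x≤N₀) mN₀≤N
    factor-y+aw : ∀ m y a w → m * y + a * (m * w) ≡ m * (y + a * w)
    factor-y+aw = solve-∀
    factor-bw : ∀ m b w → b * (m * w) ≡ m * (b * w)
    factor-bw = solve-∀

  -- Take a monochromatic progression y₀ + i d, i ≤ a N₀. Either some b d j with 1 ≤ j ≤ N₀ has its
  -- colour, and y = y₀, w = d j works, or the dilates b d · [1, N₀] avoid it and the induction
  -- hypothesis applies to them with one colour fewer.
  rado-suc : ∀ {a b r} → 1 ≤ b → RadoBound a b (suc r) → RadoBound a b (suc (suc r))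
  rado-suc {a} {b} {r} b≥1 (N₀ , triples) = W + b * (W * N₀) , triple
    where
    W : ℕ
    W = proj₁ (vanDerWaerden (a * N₀) (suc (suc r)))
    triple : ∀ c → RadoTriple c a b (W + b * (W * N₀))
    triple c = case ℕₚ.anyUpTo? (λ j → c (b * step * suc j) Finₚ.≟ c start) N₀ of λ where
        (yes (j , j<N₀ , hit)) → RadoTriple-in-AP ap (s≤s z≤n) j<N₀ hit
        (no miss) → RadoTriple-dilate (b * step) (ℕₚ.*-mono-≤ b≥1 step≥1) b≥1 bound
                      (λ { {suc j} _ j<N₀ hit → miss (j , j<N₀ , hit) })
                      (triples (recolourAvoiding (c start) (λ x → c (b * step * x))))
      where
      ap : MonoAP c (a * N₀) W
      ap = proj₂ (vanDerWaerden (a * N₀) (suc (suc r))) c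
      open MonoAP ap
      bound : b * step * N₀ ≤ W + b * (W * N₀)
      bound = ≤-trans (ℕₚ.≤-reflexive (ℕₚ.*-assoc b step N₀))
                      (≤-trans (ℕₚ.*-monoʳ-≤ b (ℕₚ.*-monoˡ-≤ N₀ step≤)) (ℕₚ.m≤n+m _ W))

  rado : ∀ a b → 1 ≤ b → ∀ r → RadoBound a b r
  rado a b b≥1 zero = 0 , λ c → ⊥-elim (Finₚ.¬Fin0 (c 0))
  rado a b b≥1 (suc zero) = suc a + b , λ c → record
    { y = 1 ; w = 1 ; y≥1 = ℕₚ.≤-refl ; w≥1 = ℕₚ.≤-refl
    ; y+aw≤N = s≤s (≤-trans (ℕₚ.≤-reflexive (ℕₚ.*-identityʳ a)) (ℕₚ.m≤m+n a b))
    ; bw≤N = ≤-trans (ℕₚ.≤-reflexive (ℕₚ.*-identityʳ b)) (ℕₚ.m≤n+m b (suc a))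
    ; colour-y+aw = single-colour _ _ ; colour-bw = single-colour _ _ }
    where
    single-colour : ∀ (i j : Fin 1) → i ≡ j
    single-colour Fin.zero Fin.zero = refl
  rado a b b≥1 (suc (suc r)) = rado-suc b≥1 (rado a b b≥1 (suc r))

-- Monochromatic solutions of s + q u = t

module _ where
  open Rational using (_+_; _*_)
  open Int using (+_; -[1+_])
  open ≡-Reasoning
  open import Data.Integer.Tactic.RingSolver using (solve-∀)

  ↧-dilation : ∀ q s w → ℕ→ℚ s + q * ℕ→ℚ (↧ₙ q Nat.* w) ≡ ℤ→ℚ (+ s Int.+ ↥ q Int.* + w)
  ↧-dilation q s w = begin
    ℕ→ℚ s + q * ℕ→ℚ (↧ₙ q Nat.* w)     ≡⟨ cong (λ z → ℕ→ℚ s + q * z) (ℕ→ℚ-* (↧ₙ q) w) ⟩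
    ℕ→ℚ s + q * (ℕ→ℚ (↧ₙ q) * ℕ→ℚ w)  ≡⟨ cong (λ z → ℕ→ℚ s + z) (ℚₚ.*-assoc q (ℕ→ℚ (↧ₙ q)) (ℕ→ℚ w)) ⟨
    ℕ→ℚ s + q * ℕ→ℚ (↧ₙ q) * ℕ→ℚ w    ≡⟨ cong (λ z → ℕ→ℚ s + z * ℕ→ℚ w) (*-↧≡↥ q) ⟩
    ℕ→ℚ s + ℤ→ℚ (↥ q) * ℕ→ℚ w         ≡⟨ cong (λ z → ℕ→ℚ s + z) (ℤ→ℚ-* (↥ q) (+ w)) ⟨
    ℕ→ℚ s + ℤ→ℚ (↥ q Int.* + w)       ≡⟨ ℤ→ℚ-+ (+ s) (↥ q Int.* + w) ⟨
    ℤ→ℚ (+ s Int.+ ↥ q Int.* + w)     ∎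

  record QTriple {r} (c : ℕ → Fin r) (q : ℚ) (N : ℕ) : Set where
    field
      s t u : ℕ
      s≥1 : 1 ≤ s
      t≥1 : 1 ≤ t
      u≥1 : 1 ≤ u
      t≤N : t ≤ N
      colour-s : c s ≡ c t
      colour-u : c u ≡ c t
      equation : ℕ→ℚ s + q * ℕ→ℚ u ≡ ℕ→ℚ t

  QTriple-from-Rado : ∀ {r} {c : ℕ → Fin r} q {N} → RadoTriple c Int.∣ ↥ q ∣ (↧ₙ q) N → QTriple c q N
  QTriple-from-Rado q@(mkℚ (+ a) d _) triple = record
    { s = y ; t = y Nat.+ a Nat.* w ; u = suc d Nat.* w
    ; s≥1 = y≥1 ; t≥1 = ℕₚ.≤-trans y≥1 (ℕₚ.m≤m+n y _) ; u≥1 = ℕₚ.*-mono-≤ (s≤s (z≤n {d})) w≥1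
    ; t≤N = y+aw≤N ; colour-s = sym colour-y+aw ; colour-u = trans colour-bw (sym colour-y+aw)
    ; equation = trans (↧-dilation q y w) (cong ℤ→ℚ (sym (begin
        + (y Nat.+ a Nat.* w)      ≡⟨ ℤₚ.pos-+ y (a Nat.* w) ⟩
        + y Int.+ + (a Nat.* w)    ≡⟨ cong (λ z → + y Int.+ z) (ℤₚ.pos-* a w) ⟩
        + y Int.+ + a Int.* + w    ∎)))
    }
    where open RadoTriple triple
  QTriple-from-Rado q@(mkℚ -[1+ a ] d _) triple = record
    { s = y Nat.+ suc a Nat.* w ; t = y ; u = suc d Nat.* w
    ; s≥1 = ℕₚ.≤-trans y≥1 (ℕₚ.m≤m+n y _) ; t≥1 = y≥1 ; u≥1 = ℕₚ.*-mono-≤ (s≤s (z≤n {d})) w≥1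
    ; t≤N = ℕₚ.≤-trans (ℕₚ.m≤m+n y _) y+aw≤N ; colour-s = colour-y+aw ; colour-u = colour-bw
    ; equation = trans (↧-dilation q (y Nat.+ suc a Nat.* w) w) (cong ℤ→ℚ (begin
        + (y Nat.+ suc a Nat.* w) Int.+ -[1+ a ] Int.* + w
          ≡⟨ cong (Int._+ -[1+ a ] Int.* + w) (ℤₚ.pos-+ y (suc a Nat.* w)) ⟩
        + y Int.+ + (suc a Nat.* w) Int.+ -[1+ a ] Int.* + w
          ≡⟨ cong (λ z → + y Int.+ z Int.+ -[1+ a ] Int.* + w) (ℤₚ.pos-* (suc a) w) ⟩
        + y Int.+ + suc a Int.* + w Int.+ Int.- + suc a Int.* + w
          ≡⟨ cancel (+ y) (+ suc a) (+ w) ⟩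
        + y
          ∎))
    }
    where
    open RadoTriple triple
    cancel : ∀ y a w → y Int.+ a Int.* w Int.+ Int.- a Int.* w ≡ y
    cancel = solve-∀

  qTriples : ∀ q r → Σ ℕ λ N → ∀ (c : ℕ → Fin r) → QTriple c q N
  qTriples q r =
    let (N , triples) = rado Int.∣ ↥ q ∣ (↧ₙ q) (s≤s z≤n) r
    in N , λ c → QTriple-from-Rado q (triples c)

-- Dilating a zero of P into a zero of P_q

_∷ʳ_ : ∀ {a} {A : Set a} {n} → (Fin n → A) → A → Fin (suc n) → A
_∷ʳ_ {n = zero} g e _ = e
_∷ʳ_ {n = suc n} g e Fin.zero = g Fin.zero
_∷ʳ_ {n = suc n} g e (Fin.suc i) = ((g ∘ Fin.suc) ∷ʳ e) i

∷ʳ-inject₁ : ∀ {a} {A : Set a} {n} (g : Fin n → A) e j → (g ∷ʳ e) (inject₁ j) ≡ g j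
∷ʳ-inject₁ g e Fin.zero = refl
∷ʳ-inject₁ g e (Fin.suc j) = ∷ʳ-inject₁ (g ∘ Fin.suc) e j

∷ʳ-fromℕ : ∀ {a} {A : Set a} {n} (g : Fin n → A) e → (g ∷ʳ e) (fromℕ n) ≡ e
∷ʳ-fromℕ {n = zero} g e = refl
∷ʳ-fromℕ {n = suc n} g e = ∷ʳ-fromℕ (g ∘ Fin.suc) e

∷ʳ-all : ∀ {a p} {A : Set a} {n} (Q : A → Set p) {g : Fin n → A} {e} →
         (∀ j → Q (g j)) → Q e → ∀ i → Q ((g ∷ʳ e) i)
∷ʳ-all {n = zero} Q Qg Qe _ = Qe
∷ʳ-all {n = suc n} Q Qg Qe Fin.zero = Qg Fin.zero
∷ʳ-all {n = suc n} Q Qg Qe (Fin.suc i) = ∷ʳ-all Q (Qg ∘ Fin.suc) Qe i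

dilatedPoint : ∀ {m} (s t u : ℕ) → (Fin (suc m) → ℕ) → Fin (suc (suc m)) → ℕ
dilatedPoint {m} s t u n =
  ((λ j → t Nat.* n (inject₁ j)) ∷ʳ (s Nat.* n (fromℕ m))) ∷ʳ (u Nat.* n (fromℕ m))

module _ where
  open Rational using (_+_; _*_)
  open ≡-Reasoning

  -- `evalPq P q x` is `eval P` at a point local to `evalPq`; this recovers that point from `refl`.
  pointOf : ∀ {k} (P : Poly k) {x : Fin k → ℚ} → eval P x ≡ eval P x → Fin k → ℚ
  pointOf _ {x} _ = x

  evalPq-eval : ∀ {m} (P : Poly (suc m)) q x (y : Fin (suc m) → ℚ) →
                x (inject₁ (fromℕ m)) + q * x (fromℕ (suc m)) ≡ y (fromℕ m) →
                (∀ j → x (inject₁ (inject₁ j)) ≡ y (inject₁ j)) → evalPq P q x ≡ eval P y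
  evalPq-eval {m} P q x y substituted unchanged = eval-cong P coordinates
    where
    coordinates : ∀ j → pointOf P (refl {x = evalPq P q x}) j ≡ y j
    coordinates j with j Fin.≟ fromℕ m
    ... | yes refl = substituted
    ... | no j≢m with Top.view j
    ...   | Top.‵fromℕ = ⊥-elim (j≢m refl)
    ...   | Top.‵inj₁ {i = j′} _ = unchanged j′

  ZeroOfPq-dilatedPoint : ∀ {m} (P : Poly (suc m)) → Homogeneous P → ∀ n → ZeroOf P n →
                          ∀ {q} s t u → ℕ→ℚ s + q * ℕ→ℚ u ≡ ℕ→ℚ t → ZeroOfPq P q (dilatedPoint s t u n)
  ZeroOfPq-dilatedPoint {m} P homogeneous@(d , _) n n-zero {q} s t u s+qu≡t = begin
    evalPq P q (ℕ→ℚ ∘ dilatedPoint s t u n)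
      ≡⟨ evalPq-eval P q (ℕ→ℚ ∘ dilatedPoint s t u n) (λ j → ℕ→ℚ t * ℕ→ℚ (n j)) substituted unchanged ⟩
    eval P (λ j → ℕ→ℚ t * ℕ→ℚ (n j))
      ≡⟨ eval-scale P homogeneous (ℕ→ℚ t) (ℕ→ℚ ∘ n) ⟩
    ℕ→ℚ t ^ℚ d * eval P (ℕ→ℚ ∘ n)
      ≡⟨ cong (ℕ→ℚ t ^ℚ d *_) n-zero ⟩
    ℕ→ℚ t ^ℚ d * 0ℚ
      ≡⟨ ℚₚ.*-zeroʳ (ℕ→ℚ t ^ℚ d) ⟩
    0ℚ
      ∎
    where
    last : ℕ
    last = n (fromℕ m)
    scaled : Fin m → ℕ
    scaled j = t Nat.* n (inject₁ j)
    substituted : ℕ→ℚ (dilatedPoint s t u n (inject₁ (fromℕ m)))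
                  + q * ℕ→ℚ (dilatedPoint s t u n (fromℕ (suc m))) ≡ ℕ→ℚ t * ℕ→ℚ last
    substituted = begin
      ℕ→ℚ (dilatedPoint s t u n (inject₁ (fromℕ m))) + q * ℕ→ℚ (dilatedPoint s t u n (fromℕ (suc m)))
        ≡⟨ cong₂ (λ a b → ℕ→ℚ a + q * ℕ→ℚ b)
                 (trans (∷ʳ-inject₁ (scaled ∷ʳ (s Nat.* last)) (u Nat.* last) (fromℕ m))
                        (∷ʳ-fromℕ scaled (s Nat.* last)))
                 (∷ʳ-fromℕ (scaled ∷ʳ (s Nat.* last)) (u Nat.* last)) ⟩
      ℕ→ℚ (s Nat.* last) + q * ℕ→ℚ (u Nat.* last)
        ≡⟨ cong₂ (λ a b → a + q * b) (ℕ→ℚ-* s last) (ℕ→ℚ-* u last) ⟩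
      ℕ→ℚ s * ℕ→ℚ last + q * (ℕ→ℚ u * ℕ→ℚ last)
        ≡⟨ cong (ℕ→ℚ s * ℕ→ℚ last +_) (ℚₚ.*-assoc q (ℕ→ℚ u) (ℕ→ℚ last)) ⟨
      ℕ→ℚ s * ℕ→ℚ last + q * ℕ→ℚ u * ℕ→ℚ last
        ≡⟨ ℚₚ.*-distribʳ-+ (ℕ→ℚ last) (ℕ→ℚ s) (q * ℕ→ℚ u) ⟨
      (ℕ→ℚ s + q * ℕ→ℚ u) * ℕ→ℚ last
        ≡⟨ cong (_* ℕ→ℚ last) s+qu≡t ⟩
      ℕ→ℚ t * ℕ→ℚ last
        ∎
    unchanged : ∀ j → ℕ→ℚ (dilatedPoint s t u n (inject₁ (inject₁ j))) ≡ ℕ→ℚ t * ℕ→ℚ (n (inject₁ j))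
    unchanged j = trans (cong ℕ→ℚ (trans (∷ʳ-inject₁ (scaled ∷ʳ (s Nat.* last)) (u Nat.* last) (inject₁ j))
                                         (∷ʳ-inject₁ scaled (s Nat.* last) j)))
                        (ℕ→ℚ-* t (n (inject₁ j)))

lemma3p7 : ∀ (m : ℕ) (P : Poly (suc m)) → Homogeneous P →
    PartitionRegular (suc m) (ZeroOf P) →
    ∀ (q : ℚ) → PartitionRegular (suc (suc m)) (ZeroOfPq P q)
lemma3p7 m P homogeneous regular q r c
  with (N , triples) ← qTriples q r
  with (_ , n , n≥1 , same-pattern , n-zero) ← regular (r ^ N) (λ x → colourPattern (λ k → c (k Nat.* x)) N)
  = χ t , dilatedPoint s t u n , point≥1 , point-colour
  , ZeroOfPq-dilatedPoint P homogeneous n n-zero s t u equation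
  where
  χ : ℕ → Fin r
  χ k = c (k Nat.* n (fromℕ m))
  open QTriple (triples χ)
  t-multiple-colour : ∀ j → c (t Nat.* n j) ≡ χ t
  t-multiple-colour j =
    colourPattern-injective _ _ N (trans (same-pattern j) (sym (same-pattern (fromℕ m)))) t≥1 t≤N
  point≥1 : ∀ i → dilatedPoint s t u n i ≥ 1
  point≥1 = ∷ʳ-all (1 ≤_) (∷ʳ-all (1 ≤_) (λ j → ℕₚ.*-mono-≤ t≥1 (n≥1 _)) (ℕₚ.*-mono-≤ s≥1 (n≥1 _)))
                   (ℕₚ.*-mono-≤ u≥1 (n≥1 _))
  point-colour : ∀ i → c (dilatedPoint s t u n i) ≡ χ t
  point-colour = ∷ʳ-all (λ x → c x ≡ χ t)
                   (∷ʳ-all (λ x → c x ≡ χ t) (t-multiple-colour ∘ inject₁) colour-s) colour-u
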